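{- Let $n \geq 11$ be an integer, and let the binary expansion of $n-3$ be $n-3 = [b_1 b_2 \cdots b_m]_2$ (with $b_1 = 1$). Define the length-$n$ subwords of $\mathbf{t}$ $\operatorname{counter}_1(n) = \mathbf{t}_{2^{m+1}-2}\mathbf{t}_{2^{m+1}-1}\cdots \mathbf{t}_{2^{m+1}+n-3}$, $\operatorname{counter}_2(n) = \mathbf{t}_{2^{m+1}+2^{m-1}-2}\mathbf{t}_{2^{m+1}+2^{m-1}-1}\cdots \mathbf{t}_{2^{m+1}+2^{m-1}+n-3}$, $\operatorname{counter}_3(n) = \mathbf{t}_{2^{m+1}+2^{m-1}+2^{m-2}-2}\cdots \mathbf{t}_{2^{m+1}+2^{m-1}+2^{m-2}+n-3}$, $\operatorname{counter}_4(n) = \mathbf{t}_{2^{m+1}+2^{m}-2}\mathbf{t}_{2^{m+1}+2^{m}-1}\cdots \mathbf{t}_{2^{m+1}+2^{m}+n-3}$. Let $w$ be a length-$n$ subword of $\mathbf{t}$. If $b_1 b_2 = 10$ and there is a subword $v \neq w$ of $\mathbf{t}$ with $v \sim_{\textsf{t}} w$, then $w$ or $v$ is equal to one of $\operatorname{counter}_1(n), \operatorname{counter}_2(n), \operatorname{counter}_3(n), \operatorname{counter}_4(n)$. If $b_1 b_2 = 11$ and there is a subword $v \neq w$ of $\mathbf{t}$ with $v \sim_{\textsf{t}} w$, then $w$ or $v$ is equal to $\operatorname{counter}_1(n)$ or $\operatorname{counter}_4(n)$.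
   Context: "Subword" means factor (contiguous block). The Thue–Morse word is $\mathbf{t} = \mathbf{t}_0 \mathbf{t}_1 \mathbf{t}_2 \cdots$, where $\mathbf{t}_n$ is the number of $1$'s in the binary expansion of $n$, taken modulo $2$. The Defant–Kravitz map $\textsf{tortoise}$ on finite words over a totally ordered alphabet (here $0<1$) is defined recursively: $\textsf{tortoise}(\varepsilon)=\varepsilon$; for a nonempty word $w$ whose largest letter $n$ occurs $k$ times, write $w = A_1 n A_2 n \cdots n A_{k+1}$ (each $A_i$ possibly empty, with all letters of $A_i$ smaller than $n$), and set $\textsf{tortoise}(w) = \textsf{tortoise}(A_1)\,\textsf{tortoise}(A_2)\, n\, \textsf{tortoise}(A_3)\, n \cdots n\, \textsf{tortoise}(A_k)\, n\, \textsf{tortoise}(A_{k+1})\, n$. Two words are tortoise-equivalent ($w\sim_{\textsf{t}} v$) if $\textsf{tortoise}(w)=\textsf{tortoise}(v)$. -}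

module Defs where

open import Data.Nat using (ℕ; zero; suc; _+_; _*_; _∸_; _^_; _⊔_; _≟_; ⌊_/2⌋; _%_)
open import Data.Bool using (Bool; true; false; not; if_then_else_)
open import Data.List using (List; []; _∷_; _++_; map; length; foldr; concatMap; upTo; [_])
open import Data.Product using (∃; _,_)
open import Relation.Binary.PropositionalEquality using (_≡_)
open import Relation.Nullary.Decidable using (⌊_⌋)

-- Thue–Morse: t_n = (number of 1's in binary expansion of n) mod 2.
-- Computed with fuel: t_0 = 0, t_{2k} = t_k, t_{2k+1} = 1 - t_k  (fuel n suffices).
tmAux : ℕ → ℕ → ℕ
tmAux zero    _ = 0
tmAux (suc f) zero = 0
tmAux (suc f) (suc k) with (suc k) % 2
... | zero  = tmAux f ⌊ suc k /2⌋
... | suc _ = 1 ∸ tmAux f ⌊ suc k /2⌋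

tm : ℕ → ℕ
tm n = tmAux n n

factorAt : ℕ → ℕ → List ℕ
factorAt i len = map (λ j → tm (i + j)) (upTo len)

IsFactor : List ℕ → Set
IsFactor w = ∃ λ i → w ≡ factorAt i (length w)

-- the Defant–Kravitz tortoise map on words over ℕ (natural order)
maxL : List ℕ → ℕ
maxL = foldr _⊔_ 0

-- split w at every occurrence of letter n: w = A₁ n A₂ n ⋯ n A_{k+1}
splitAt' : ℕ → List ℕ → List (List ℕ)
splitAt' n [] = [] ∷ []
splitAt' n (x ∷ xs) with splitAt' n xs
... | r with ⌊ x ≟ n ⌋
...   | true  = [] ∷ r
...   | false with r
...     | []      = [ x ∷ [] ]
...     | (b ∷ bs) = (x ∷ b) ∷ bs

assemble : ℕ → List (List ℕ) → List ℕ
assemble n []       = []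
assemble n (b ∷ bs) = b ++ concatMap (λ c → c ++ [ n ]) bs

-- fuel-based recursion; fuel = length w suffices since every block is shorter
tortoiseAux : ℕ → List ℕ → List ℕ
tortoiseAux zero    _  = []
tortoiseAux (suc f) [] = []
tortoiseAux (suc f) (x ∷ xs) =
  assemble (maxL (x ∷ xs)) (map (tortoiseAux f) (splitAt' (maxL (x ∷ xs)) (x ∷ xs)))

tortoise : List ℕ → List ℕ
tortoise w = tortoiseAux (length w) w

-- bit j of x (j-th binary digit counting from least significant, starting at 0)
shiftR : ℕ → ℕ → ℕ
shiftR x zero    = x
shiftR x (suc j) = ⌊ shiftR x j /2⌋

bit : ℕ → ℕ → ℕ
bit x j = shiftR x j % 2

-- counter words, with m = number of binary digits of n - 3
counter₁ counter₂ counter₃ counter₄ : ℕ → ℕ → List ℕ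
counter₁ m n = factorAt (2 ^ (m + 1) ∸ 2) n
counter₂ m n = factorAt (2 ^ (m + 1) + 2 ^ (m ∸ 1) ∸ 2) n
counter₃ m n = factorAt (2 ^ (m + 1) + 2 ^ (m ∸ 1) + 2 ^ (m ∸ 2) ∸ 2) n
counter₄ m n = factorAt (2 ^ (m + 1) + 2 ^ m ∸ 2) n

-- For a binary word containing a 1, tortoise deletes the first 1 and appends a 1 at the end.
-- So two distinct tortoise-equivalent factors differ by moving their first 1 to the right across
-- zeros, and as t contains no 000 they are 10y and 01y, or 100y and 001y, or 010y and 001y.
--
-- The rest is desubstitution along t = μ(t), μ(0) = 01, μ(1) = 10. A mismatch t_X ≠ t_Y followed
-- by four agreeing letters forces X, Y odd with t_{(X-1)/2} ≠ t_{(Y-1)/2}; iterating r times along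
-- an agreement of length L, 3·2^r < 2L, gives X + 1 = 2^r (P + 1), Y + 1 = 2^r (Q + 1), t_P ≠ t_Q,
-- so the μ^r-blocks of P and Q mismatch letter by letter. This excludes the last two shapes, whose
-- mismatch at position 2 is preceded by an agreement. For 10y and 01y, take r = m - 2: then w, v
-- start at 2^r (P + 1) - 2 and 2^r (Q + 1) - 2, and the factors of length 4 (length 5 if b₂ = 1)
-- at P and Q differ exactly in their first letter. A finite check shows that of two such factors
-- one occurs at 7, 9, 10 or 11 (at 7 or 11 for length 5), and μ^r carries this occurrence to a
-- counter word.

module Submission where

open import Defs
open import Data.Nat hiding (parity)
open import Data.Nat.Properties
open import Data.Nat.DivMod
  using (_/_; m*n%n≡0; [m+kn]%n≡m%n; m/n≡1+[m∸n]/n; m/n*n≤m; m≡m%n+[m/n]*n; m%n<n)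
open import Data.Nat.Induction using (<-rec)
open import Data.Nat.Tactic.RingSolver using (solve-∀)
open import Data.List using (List; []; _∷_; _++_; map; length; upTo; applyUpTo; [_]; replicate; concatMap)
open import Data.List.Properties
  using (map-upTo; ∷-injective; ∷-injectiveˡ; ∷-injectiveʳ; ≡-dec; length-++; length-++-sucʳ; ++-assoc; ++-identityʳ;
         ++-cancelˡ; ++-cancelʳ; map-id-local; map-replicate)
open import Data.List.Relation.Unary.All as All using (All; []; _∷_)
open import Data.List.Relation.Unary.Any as Any using (Any; here; there)
open import Data.List.Membership.Propositional.Properties using (∈-upTo⁺; ∈-upTo⁻)
open import Data.List.Membership.Propositional using (_∈_; find)
open import Data.Product using (∃; ∃₂; _×_; _,_; proj₁; proj₂)
open import Data.Sum as Sum using (_⊎_; inj₁; inj₂)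
open import Data.Empty using (⊥-elim)
open import Function using (_∘_; case_of_)
open import Relation.Binary.PropositionalEquality hiding ([_])
open import Relation.Binary.Definitions using (Tri; tri<; tri≈; tri>)
open import Relation.Nullary using (¬_; Dec; yes; no)
open import Relation.Nullary.Decidable using (toWitness; ¬?; _→-dec_; _⊎-dec_)

data IsBit : ℕ → Set where
  bit0 : IsBit 0
  bit1 : IsBit 1

complement-isBit : ∀ {x} → IsBit x → IsBit (1 ∸ x)
complement-isBit bit0 = bit1
complement-isBit bit1 = bit0

complement-injective : ∀ {x y} → IsBit x → IsBit y → 1 ∸ x ≡ 1 ∸ y → x ≡ y
complement-injective bit0 bit0 _ = refl
complement-injective bit1 bit1 _ = refl

complement-involutive : ∀ {x} → IsBit x → 1 ∸ (1 ∸ x) ≡ x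
complement-involutive bit0 = refl
complement-involutive bit1 = refl

complement-≢ : ∀ {x} → IsBit x → x ≢ 1 ∸ x
complement-≢ bit0 ()
complement-≢ bit1 ()

0≢1 : 0 ≢ 1
0≢1 ()

data Parity : ℕ → Set where
  even : ∀ h → Parity (2 * h)
  odd  : ∀ h → Parity (suc (2 * h))

parity : ∀ n → Parity n
parity zero = even 0
parity (suc n) with parity n
... | even h = odd h
... | odd h  = subst Parity (*-suc 2 h) (even (suc h))

⌊1+n/2⌋≤ : ∀ {n f} → n ≤ f → ⌊ suc n /2⌋ ≤ f
⌊1+n/2⌋≤ {n} = ≤-trans (≤-pred (⌊n/2⌋<n n))

tmAux-fuel : ∀ {f g} n → n ≤ f → n ≤ g → tmAux f n ≡ tmAux g n
tmAux-fuel {zero}  {zero}  zero _ _ = refl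
tmAux-fuel {zero}  {suc g} zero _ _ = refl
tmAux-fuel {suc f} {zero}  zero _ _ = refl
tmAux-fuel {suc f} {suc g} zero _ _ = refl
tmAux-fuel {suc f} {suc g} (suc n) (s≤s n≤f) (s≤s n≤g) with suc n % 2
... | zero  = tmAux-fuel ⌊ suc n /2⌋ (⌊1+n/2⌋≤ n≤f) (⌊1+n/2⌋≤ n≤g)
... | suc _ = cong (1 ∸_) (tmAux-fuel ⌊ suc n /2⌋ (⌊1+n/2⌋≤ n≤f) (⌊1+n/2⌋≤ n≤g))

isBit-tmAux : ∀ f n → IsBit (tmAux f n)
isBit-tmAux zero    n       = bit0
isBit-tmAux (suc f) zero    = bit0
isBit-tmAux (suc f) (suc n) with suc n % 2
... | zero  = isBit-tmAux f ⌊ suc n /2⌋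
... | suc _ = complement-isBit (isBit-tmAux f ⌊ suc n /2⌋)

isBit-tm : ∀ n → IsBit (tm n)
isBit-tm n = isBit-tmAux n n

tm-even-step : ∀ {n} → n % 2 ≡ 0 → tm n ≡ tm ⌊ n /2⌋
tm-even-step {zero} _ = refl
tm-even-step {suc n} e with suc n % 2 | e
... | zero | _ = tmAux-fuel ⌊ suc n /2⌋ (⌊1+n/2⌋≤ ≤-refl) ≤-refl

tm-odd-step : ∀ {n} → n % 2 ≡ 1 → tm n ≡ 1 ∸ tm ⌊ n /2⌋
tm-odd-step {suc n} e with suc n % 2 | e
... | suc zero | _ = cong (1 ∸_) (tmAux-fuel ⌊ suc n /2⌋ (⌊1+n/2⌋≤ ≤-refl) ≤-refl)

⌊2*n/2⌋≡n : ∀ n → ⌊ 2 * n /2⌋ ≡ n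
⌊2*n/2⌋≡n n = trans (cong (λ m → ⌊ n + m /2⌋) (+-identityʳ n)) (sym (n≡⌊n+n/2⌋ n))

⌊1+2*n/2⌋≡n : ∀ n → ⌊ suc (2 * n) /2⌋ ≡ n
⌊1+2*n/2⌋≡n zero = refl
⌊1+2*n/2⌋≡n (suc n) = cong suc (trans (cong ⌊_/2⌋ (+-suc n (n + 0))) (⌊1+2*n/2⌋≡n n))

tm-double : ∀ n → tm (2 * n) ≡ tm n
tm-double n = trans (tm-even-step {2 * n} (trans (cong (_% 2) (*-comm 2 n)) (m*n%n≡0 n 2)))
                    (cong tm (⌊2*n/2⌋≡n n))

tm-double+1 : ∀ n → tm (suc (2 * n)) ≡ 1 ∸ tm n
tm-double+1 n =
  trans (tm-odd-step {suc (2 * n)} (trans (cong (λ m → suc m % 2) (*-comm 2 n)) ([m+kn]%n≡m%n 1 n 2)))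
        (cong (λ m → 1 ∸ tm m) (⌊1+2*n/2⌋≡n n))

tm-double+2 : ∀ n → tm (2 + 2 * n) ≡ tm (suc n)
tm-double+2 n = trans (cong tm (sym (*-suc 2 n))) (tm-double (suc n))

tm-double+3 : ∀ n → tm (3 + 2 * n) ≡ 1 ∸ tm (suc n)
tm-double+3 n = trans (cong (tm ∘ suc) (sym (*-suc 2 n))) (tm-double+1 (suc n))

tm-double+4 : ∀ n → tm (4 + 2 * n) ≡ tm (2 + n)
tm-double+4 n = trans (cong (tm ∘ suc ∘ suc) (sym (*-suc 2 n))) (tm-double+2 (suc n))

tm-2^r* : ∀ r n → tm (2 ^ r * n) ≡ tm n
tm-2^r* zero    n = cong tm (+-identityʳ n)
tm-2^r* (suc r) n = trans (cong tm (*-assoc 2 (2 ^ r) n)) (trans (tm-double (2 ^ r * n)) (tm-2^r* r n))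

tm-no-three-equal : ∀ n → tm n ≡ tm (1 + n) → tm (1 + n) ≢ tm (2 + n)
tm-no-three-equal n e₁ e₂ with parity n
... | even h = complement-≢ (isBit-tm h) (trans (sym (tm-double h)) (trans e₁ (tm-double+1 h)))
... | odd h  = complement-≢ (isBit-tm (suc h))
                 (trans (sym (tm-double+2 h)) (trans e₂ (tm-double+3 h)))

window : ℕ → ℕ → List ℕ
window i zero    = []
window i (suc L) = tm i ∷ window (suc i) L

applyUpTo≡window : ∀ i L {f : ℕ → ℕ} → (∀ k → f k ≡ tm (i + k)) → applyUpTo f L ≡ window i L
applyUpTo≡window i zero    f≗ = refl
applyUpTo≡window i (suc L) f≗ =
  cong₂ _∷_ (trans (f≗ 0) (cong tm (+-identityʳ i)))
            (applyUpTo≡window (suc i) L (λ k → trans (f≗ (suc k)) (cong tm (+-suc i k))))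

factorAt≡window : ∀ i L → factorAt i L ≡ window i L
factorAt≡window i L = trans (map-upTo _ L) (applyUpTo≡window i L (λ _ → refl))

length-window : ∀ i L → length (window i L) ≡ L
length-window i zero    = refl
length-window i (suc L) = cong suc (length-window (suc i) L)

isBit-window : ∀ i L → All IsBit (window i L)
isBit-window i zero    = []
isBit-window i (suc L) = isBit-tm i ∷ isBit-window (suc i) L

window-≡⁻ : ∀ {i j L} → window i L ≡ window j L → ∀ k → k < L → tm (k + i) ≡ tm (k + j)
window-≡⁻ {L = suc L} e zero    _         = ∷-injectiveˡ e
window-≡⁻ {i} {j} {suc L} e (suc k) (s≤s k<L) =
  trans (cong tm (sym (+-suc k i))) (trans (window-≡⁻ (∷-injectiveʳ e) k k<L) (cong tm (+-suc k j)))

window-≡⁺ : ∀ {i j} L → (∀ k → k < L → tm (k + i) ≡ tm (k + j)) → window i L ≡ window j L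
window-≡⁺ zero    _ = refl
window-≡⁺ {i} {j} (suc L) agree = cong₂ _∷_ (agree 0 z<s) (window-≡⁺ L agree′)
  where
  agree′ : ∀ k → k < L → tm (k + suc i) ≡ tm (k + suc j)
  agree′ k k<L = trans (cong tm (+-suc k i)) (trans (agree (suc k) (s≤s k<L)) (cong tm (sym (+-suc k j))))

window-shift : ∀ {i j L} d L′ → d + L′ ≤ L → window i L ≡ window j L → window (d + i) L′ ≡ window (d + j) L′
window-shift {i} {j} d L′ d+L′≤L e = window-≡⁺ L′ λ k k<L′ →
  trans (cong tm (sym (+-assoc k d i)))
        (trans (window-≡⁻ e (k + d) (≤-trans (subst (_≤ d + L′) (+-comm d (suc k)) (+-monoʳ-≤ d k<L′)) d+L′≤L))
               (cong tm (+-assoc k d j)))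

window-double : ∀ {i j} L → window i L ≡ window j L → window (2 * i) (2 * L) ≡ window (2 * j) (2 * L)
window-double {i} {j} L e = window-≡⁺ (2 * L) agree
  where
  agree : ∀ k → k < 2 * L → tm (k + 2 * i) ≡ tm (k + 2 * j)
  agree k k<2L with parity k
  ... | even h = begin
    tm (2 * h + 2 * i) ≡⟨ cong tm (sym (*-distribˡ-+ 2 h i)) ⟩
    tm (2 * (h + i))   ≡⟨ tm-double (h + i) ⟩
    tm (h + i)         ≡⟨ window-≡⁻ e h (*-cancelˡ-< 2 h L k<2L) ⟩
    tm (h + j)         ≡⟨ sym (tm-double (h + j)) ⟩
    tm (2 * (h + j))   ≡⟨ cong tm (*-distribˡ-+ 2 h j) ⟩
    tm (2 * h + 2 * j) ∎
    where open ≡-Reasoning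
  ... | odd h = begin
    tm (suc (2 * h + 2 * i)) ≡⟨ cong (tm ∘ suc) (sym (*-distribˡ-+ 2 h i)) ⟩
    tm (suc (2 * (h + i)))   ≡⟨ tm-double+1 (h + i) ⟩
    1 ∸ tm (h + i)           ≡⟨ cong (1 ∸_) (window-≡⁻ e h (*-cancelˡ-< 2 h L (<-trans (n<1+n _) k<2L))) ⟩
    1 ∸ tm (h + j)           ≡⟨ sym (tm-double+1 (h + j)) ⟩
    tm (suc (2 * (h + j)))   ≡⟨ cong (tm ∘ suc) (*-distribˡ-+ 2 h j) ⟩
    tm (suc (2 * h + 2 * j)) ∎
    where open ≡-Reasoning

window-2^r* : ∀ r {i j} L → window i L ≡ window j L →
              window (2 ^ r * i) (2 ^ r * L) ≡ window (2 ^ r * j) (2 ^ r * L)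
window-2^r* zero {i} {j} L e rewrite +-identityʳ i | +-identityʳ j | +-identityʳ L = e
window-2^r* (suc r) {i} {j} L e rewrite *-assoc 2 (2 ^ r) i | *-assoc 2 (2 ^ r) j | *-assoc 2 (2 ^ r) L =
  window-double (2 ^ r * L) (window-2^r* r L e)

window-sample : ∀ r {A B L} M → 2 ^ r * M < L → window (2 ^ r * A) L ≡ window (2 ^ r * B) L →
                window A (suc M) ≡ window B (suc M)
window-sample r {A} {B} M 2^rM<L e = window-≡⁺ (suc M) λ k k≤M → begin
  tm (k + A)                 ≡⟨ sym (tm-2^r* r (k + A)) ⟩
  tm (2 ^ r * (k + A))       ≡⟨ cong tm (*-distribˡ-+ (2 ^ r) k A) ⟩
  tm (2 ^ r * k + 2 ^ r * A) ≡⟨ window-≡⁻ e (2 ^ r * k) (≤-<-trans (*-monoʳ-≤ (2 ^ r) (≤-pred k≤M)) 2^rM<L) ⟩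
  tm (2 ^ r * k + 2 ^ r * B) ≡⟨ cong tm (sym (*-distribˡ-+ (2 ^ r) k B)) ⟩
  tm (2 ^ r * (k + B))       ≡⟨ tm-2^r* r (k + B) ⟩
  tm (k + B)                 ∎
  where open ≡-Reasoning

-- Desubstitution

odd-even-windows-differ : ∀ p q → window (suc (2 * p)) 4 ≢ window (2 * q) 4
odd-even-windows-differ p q e = tm-no-three-equal p
  (trans (sym (complement-involutive (isBit-tm p))) (trans (cong (1 ∸_) a₀) (sym a₁)))
  (trans (sym (complement-involutive (isBit-tm (1 + p)))) (trans (cong (1 ∸_) a₂) (sym a₃)))
  where
  agree : ∀ k → k < 4 → tm (k + suc (2 * p)) ≡ tm (k + 2 * q)
  agree = window-≡⁻ e
  a₀ : 1 ∸ tm p ≡ tm q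
  a₀ = trans (sym (tm-double+1 p)) (trans (agree 0 (s≤s z≤n)) (tm-double q))
  a₁ : tm (1 + p) ≡ 1 ∸ tm q
  a₁ = trans (sym (tm-double+2 p)) (trans (agree 1 (s≤s (s≤s z≤n))) (tm-double+1 q))
  a₂ : 1 ∸ tm (1 + p) ≡ tm (1 + q)
  a₂ = trans (sym (tm-double+3 p)) (trans (agree 2 (s≤s (s≤s (s≤s z≤n)))) (tm-double+2 q))
  a₃ : tm (2 + p) ≡ 1 ∸ tm (1 + q)
  a₃ = trans (sym (tm-double+4 p)) (trans (agree 3 ≤-refl) (tm-double+3 q))

mismatch-before-match⇒odd : ∀ {X Y} → tm X ≢ tm Y → window (suc X) 4 ≡ window (suc Y) 4 →
                             ∃₂ λ p q → X ≡ suc (2 * p) × Y ≡ suc (2 * q) × tm p ≢ tm q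
mismatch-before-match⇒odd {X} {Y} X≢Y e with parity X | parity Y
... | even p | even q = ⊥-elim (X≢Y (trans (tm-double p) (trans tp≡tq (sym (tm-double q)))))
  where
  tp≡tq : tm p ≡ tm q
  tp≡tq = complement-injective (isBit-tm p) (isBit-tm q)
            (trans (sym (tm-double+1 p)) (trans (∷-injectiveˡ e) (tm-double+1 q)))
... | even p | odd q  =
  ⊥-elim (odd-even-windows-differ p (suc q) (trans e (cong (λ m → window m 4) (sym (*-suc 2 q)))))
... | odd p  | even q =
  ⊥-elim (odd-even-windows-differ q (suc p) (trans (sym e) (cong (λ m → window m 4) (sym (*-suc 2 p)))))
... | odd p  | odd q  = p , q , refl , refl , λ tp≡tq →
  X≢Y (trans (tm-double+1 p) (trans (cong (1 ∸_) tp≡tq) (sym (tm-double+1 q))))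

3*[2*n]≡2*[n*3] : ∀ n → 3 * (2 * n) ≡ 2 * (n * 3)
3*[2*n]≡2*[n*3] = solve-∀

2^r*[2+2n]≡2^[1+r]*[1+n] : ∀ r n → 2 ^ r * (2 + 2 * n) ≡ 2 ^ suc r * suc n
2^r*[2+2n]≡2^[1+r]*[1+n] r n = begin
  2 ^ r * (2 + 2 * n)  ≡⟨ cong (2 ^ r *_) (sym (*-suc 2 n)) ⟩
  2 ^ r * (2 * suc n)  ≡⟨ sym (*-assoc (2 ^ r) 2 (suc n)) ⟩
  2 ^ r * 2 * suc n    ≡⟨ cong (_* suc n) (*-comm (2 ^ r) 2) ⟩
  2 ^ suc r * suc n    ∎
  where open ≡-Reasoning

desubstitute : ∀ r {X Y L} → 3 * 2 ^ r < 2 * L → tm X ≢ tm Y → window (suc X) L ≡ window (suc Y) L →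
               ∃₂ λ P Q → suc X ≡ 2 ^ r * suc P × suc Y ≡ 2 ^ r * suc Q × tm P ≢ tm Q
desubstitute zero {X} {Y} _ X≢Y _ = X , Y , sym (+-identityʳ (suc X)) , sym (+-identityʳ (suc Y)) , X≢Y
desubstitute (suc r) {X} {Y} {L} bound X≢Y e
  with desubstitute r (≤-<-trans (*-monoʳ-≤ 3 (m≤n*m (2 ^ r) 2)) bound) X≢Y e
... | P , Q , eX , eY , P≢Q
  with mismatch-before-match⇒odd {P} {Q} P≢Q
         (window-sample r 3 (*-cancelˡ-< 2 _ _ (subst (_< 2 * L) (3*[2*n]≡2*[n*3] (2 ^ r)) bound))
                        (subst₂ (λ A B → window A L ≡ window B L) eX eY e))
... | p , q , refl , refl , p≢q =
  p , q , trans eX (2^r*[2+2n]≡2^[1+r]*[1+n] r p) , trans eY (2^r*[2+2n]≡2^[1+r]*[1+n] r q) , p≢q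

double-block : ∀ r h A → 2 * h + 2 ^ suc r * A ≡ 2 * (h + 2 ^ r * A)
double-block r h A = trans (cong (2 * h +_) (*-assoc 2 (2 ^ r) A)) (sym (*-distribˡ-+ 2 h (2 ^ r * A)))

tm-block-mismatch : ∀ r {P Q} k → k < 2 ^ r → tm P ≢ tm Q → tm (k + 2 ^ r * P) ≢ tm (k + 2 ^ r * Q)
tm-block-mismatch zero {P} {Q} zero _ P≢Q e =
  P≢Q (subst₂ (λ A B → tm A ≡ tm B) (+-identityʳ P) (+-identityʳ Q) e)
tm-block-mismatch zero (suc k) (s≤s ())
tm-block-mismatch (suc r) {P} {Q} k k<2^[1+r] P≢Q e with parity k
... | even h = tm-block-mismatch r h (*-cancelˡ-< 2 h (2 ^ r) k<2^[1+r]) P≢Q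
                 (trans (sym (descend P)) (trans e (descend Q)))
  where
  descend : ∀ A → tm (2 * h + 2 ^ suc r * A) ≡ tm (h + 2 ^ r * A)
  descend A = trans (cong tm (double-block r h A)) (tm-double (h + 2 ^ r * A))
... | odd h  = tm-block-mismatch r h (*-cancelˡ-< 2 h (2 ^ r) (<-trans (n<1+n _) k<2^[1+r])) P≢Q
                 (complement-injective (isBit-tm (h + 2 ^ r * P)) (isBit-tm (h + 2 ^ r * Q))
                                       (trans (sym (descend P)) (trans e (descend Q))))
  where
  descend : ∀ A → tm (suc (2 * h + 2 ^ suc r * A)) ≡ 1 ∸ tm (h + 2 ^ r * A)
  descend A = trans (cong (tm ∘ suc) (double-block r h A)) (tm-double+1 (h + 2 ^ r * A))

mismatch-spreads-left : ∀ {i j L} → 7 ≤ L → tm (2 + i) ≢ tm (2 + j) → window (3 + i) L ≡ window (3 + j) L →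
                        tm i ≢ tm j × tm (1 + i) ≢ tm (1 + j)
mismatch-spreads-left {i} {j} {L} 7≤L ne e =
  spread (desubstitute 2 {2 + i} {2 + j} {L} (≤-trans (n≤1+n 13) (*-monoʳ-≤ 2 7≤L)) ne e)
  where
  position : ∀ {A B} k → 3 + A ≡ 4 * suc B → k + A ≡ suc k + 4 * B
  position {A} {B} k e =
    trans (cong (k +_) (suc-injective (suc-injective (suc-injective (trans e (*-suc 4 B)))))) (+-suc k (4 * B))
  spread : (∃₂ λ P Q → 3 + i ≡ 4 * suc P × 3 + j ≡ 4 * suc Q × tm P ≢ tm Q) →
           tm i ≢ tm j × tm (1 + i) ≢ tm (1 + j)
  spread (P , Q , eP , eQ , P≢Q) = mismatch 0 (s≤s (s≤s z≤n)) , mismatch 1 (s≤s (s≤s (s≤s z≤n)))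
    where
    mismatch : ∀ k → suc k < 4 → tm (k + i) ≢ tm (k + j)
    mismatch k k<3 = subst₂ (λ A B → tm A ≢ tm B) (sym (position k eP)) (sym (position k eQ))
                            (tm-block-mismatch 2 {P} {Q} (suc k) k<3 P≢Q)

OccursAt : List ℕ → ℕ → ℕ → Set
OccursAt Cs L P = Any (λ C → window P L ≡ window C L) Cs

-- The factor of length L + 1 at d + 2h (d ≤ 1) lies inside μ of the factor of length L + 1 at h,
-- so occurrences of the factors at positions below 2B propagate to all positions.
window-occurs-early : ∀ B L .{{_ : NonZero B}} → All (OccursAt (upTo B) (suc L)) (upTo (2 * B)) →
                      ∀ P → OccursAt (upTo B) (suc L) P
window-occurs-early B L closed = <-rec _ occurs
  where
  closed-at : ∀ {P} → P < 2 * B → OccursAt (upTo B) (suc L) P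
  closed-at P<2B = All.lookup closed (∈-upTo⁺ P<2B)

  child : ∀ d h → d ≤ 1 → OccursAt (upTo B) (suc L) h → OccursAt (upTo B) (suc L) (d + 2 * h)
  child d h d≤1 occ =
    let h′ , h′∈ , e = find occ
    in Any.map (trans (window-shift d (suc L) d+1+L≤2*[1+L] (window-double (suc L) e))) (closed-at (d+2h′<2B h′∈))
    where
    d+1+L≤2*[1+L] : d + suc L ≤ 2 * suc L
    d+1+L≤2*[1+L] = ≤-trans (+-monoˡ-≤ (suc L) (≤-trans d≤1 (s≤s z≤n)))
                            (≤-reflexive (cong (suc L +_) (sym (+-identityʳ (suc L)))))
    d+2h′<2B : ∀ {h′} → h′ ∈ upTo B → d + 2 * h′ < 2 * B
    d+2h′<2B {h′} h′∈ = ≤-trans (s≤s (+-monoˡ-≤ (2 * h′) d≤1))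
                               (≤-trans (≤-reflexive (sym (*-suc 2 h′))) (*-monoʳ-≤ 2 (∈-upTo⁻ h′∈)))

  occurs : ∀ P → (∀ {h} → h < P → OccursAt (upTo B) (suc L) h) → OccursAt (upTo B) (suc L) P
  occurs P rec with P <? 2 * B | parity P
  ... | yes P<2B | _           = closed-at P<2B
  ... | no P≮2B  | even zero   = ⊥-elim (P≮2B (<-≤-trans (>-nonZero⁻¹ B) (m≤n*m B 2)))
  ... | no _     | even h@(suc _) = child 0 h z≤n (rec (m<m+n h z<s))
  ... | no _     | odd h       = child 1 h ≤-refl (rec (s≤s (m≤n*m h 2)))

OneOccursAt : List ℕ → ℕ → ℕ → ℕ → Set
OneOccursAt Cs L P Q = tm P ≢ tm Q → window (suc P) L ≡ window (suc Q) L →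
                       OccursAt Cs (suc L) P ⊎ OccursAt Cs (suc L) Q

one-occurs-at : ∀ B L Cs .{{_ : NonZero B}} → All (OccursAt (upTo B) (suc L)) (upTo (2 * B)) →
                All (λ P → All (OneOccursAt Cs L P) (upTo B)) (upTo B) → ∀ P Q → OneOccursAt Cs L P Q
one-occurs-at B L Cs closed table P Q P≢Q tails =
  let P′ , P′∈ , eP = find (window-occurs-early B L closed P)
      Q′ , Q′∈ , eQ = find (window-occurs-early B L closed Q)
      P′≢Q′ = λ e → P≢Q (trans (∷-injectiveˡ eP) (trans e (sym (∷-injectiveˡ eQ))))
      tails′ = trans (sym (∷-injectiveʳ eP)) (trans tails (∷-injectiveʳ eQ))
  in Sum.map (Any.map (trans eP)) (Any.map (trans eQ)) (All.lookup (All.lookup table P′∈) Q′∈ P′≢Q′ tails′)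

window? : ∀ L P Q → Dec (window P L ≡ window Q L)
window? L P Q = ≡-dec _≟_ (window P L) (window Q L)

closed? : ∀ B L → Dec (All (OccursAt (upTo B) L) (upTo (2 * B)))
closed? B L = All.all? (λ P → Any.any? (window? L P) (upTo B)) (upTo (2 * B))

table? : ∀ B L Cs → Dec (All (λ P → All (OneOccursAt Cs L P) (upTo B)) (upTo B))
table? B L Cs = All.all? (λ P → All.all? (λ Q → oneOccursAt? P Q) (upTo B)) (upTo B)
  where
  oneOccursAt? : ∀ P Q → Dec (OneOccursAt Cs L P Q)
  oneOccursAt? P Q = ¬? (tm P ≟ tm Q) →-dec (window? L (suc P) (suc Q) →-dec
                     (Any.any? (window? (suc L) P) Cs ⊎-dec Any.any? (window? (suc L) Q) Cs))

-- Of two factors 0u, 1u of length 4 one is t₇…t₁₀ = 1100, t₉…t₁₂ = 0010, t₁₀…t₁₃ = 0101 or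
-- t₁₁…t₁₄ = 1011; of length 5, one is t₇…t₁₁ = 11001 or t₁₁…t₁₅ = 10110. Both are checked by
-- evaluation, every factor of these lengths occurring before position 12.
left-special-4 : ∀ P Q → OneOccursAt (7 ∷ 9 ∷ 10 ∷ 11 ∷ []) 3 P Q
left-special-4 = one-occurs-at 12 3 _ (toWitness {a? = closed? 12 4} _) (toWitness {a? = table? 12 3 _} _)

left-special-5 : ∀ P Q → OneOccursAt (7 ∷ 11 ∷ []) 4 P Q
left-special-5 = one-occurs-at 12 4 _ (toWitness {a? = closed? 12 5} _) (toWitness {a? = table? 12 4 _} _)

-- The tortoise map on binary words

[]≢++[x] : ∀ (xs : List ℕ) {x} → [] ≢ xs ++ [ x ]
[]≢++[x] []      ()
[]≢++[x] (_ ∷ _) ()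

splitAt'-concat : ∀ M w → concatMap (λ c → c ++ [ M ]) (splitAt' M w) ≡ w ++ [ M ]
splitAt'-concat M [] = refl
splitAt'-concat M (x ∷ xs) with splitAt' M xs | splitAt'-concat M xs
... | r | ih with x ≟ M
... | yes refl = cong (x ∷_) ih
... | no _ with r
...   | []     = ⊥-elim ([]≢++[x] xs ih)
...   | b ∷ bs = cong (x ∷_) ih

length-assemble-map-≤ : ∀ M (T : List ℕ → List ℕ) → (∀ b → length (T b) ≤ length b) →
                        ∀ bs → length (assemble M (map T bs)) ≤ length (assemble M bs)
length-assemble-map-≤ M T shrinks [] = z≤n
length-assemble-map-≤ M T shrinks (b ∷ bs) = begin
  length (T b ++ blocks (map T bs))          ≡⟨ length-++ (T b) ⟩
  length (T b) + length (blocks (map T bs))  ≤⟨ +-mono-≤ (shrinks b) (length-blocks-≤ bs) ⟩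
  length b + length (blocks bs)              ≡⟨ sym (length-++ b) ⟩
  length (b ++ blocks bs)                    ∎
  where
  open ≤-Reasoning
  blocks : List (List ℕ) → List ℕ
  blocks = concatMap (λ c → c ++ [ M ])
  length-blocks-≤ : ∀ cs → length (blocks (map T cs)) ≤ length (blocks cs)
  length-blocks-≤ [] = z≤n
  length-blocks-≤ (c ∷ cs) = begin
    length ((T c ++ [ M ]) ++ blocks (map T cs))       ≡⟨ length-++ (T c ++ [ M ]) ⟩
    length (T c ++ [ M ]) + length (blocks (map T cs)) ≡⟨ cong (_+ _) (length-++ (T c)) ⟩
    length (T c) + 1 + length (blocks (map T cs))      ≤⟨ +-mono-≤ (+-monoˡ-≤ 1 (shrinks c)) (length-blocks-≤ cs) ⟩
    length c + 1 + length (blocks cs)                  ≡⟨ cong (_+ _) (sym (length-++ c)) ⟩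
    length (c ++ [ M ]) + length (blocks cs)           ≡⟨ sym (length-++ (c ++ [ M ])) ⟩
    length ((c ++ [ M ]) ++ blocks cs)                 ∎

length-assemble-splitAt' : ∀ M w → length (assemble M (splitAt' M w)) ≡ length w
length-assemble-splitAt' M w with splitAt' M w | splitAt'-concat M w
... | []     | e = ⊥-elim ([]≢++[x] w e)
... | b ∷ bs | e = suc-injective (begin
  suc (length (b ++ blocks))        ≡⟨ sym (length-++-sucʳ b M blocks) ⟩
  length (b ++ M ∷ blocks)          ≡⟨ cong length (sym (++-assoc b [ M ] blocks)) ⟩
  length ((b ++ [ M ]) ++ blocks)   ≡⟨ cong length e ⟩
  length (w ++ [ M ])               ≡⟨ length-++ w ⟩
  length w + 1                      ≡⟨ +-comm (length w) 1 ⟩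
  suc (length w)                    ∎)
  where
  open ≡-Reasoning
  blocks = concatMap (λ c → c ++ [ M ]) bs

length-tortoiseAux-≤ : ∀ f w → length (tortoiseAux f w) ≤ length w
length-tortoiseAux-≤ zero    w        = z≤n
length-tortoiseAux-≤ (suc f) []       = z≤n
length-tortoiseAux-≤ (suc f) w@(_ ∷ _) =
  ≤-trans (length-assemble-map-≤ (maxL w) (tortoiseAux f) (length-tortoiseAux-≤ f) (splitAt' (maxL w) w))
          (≤-reflexive (length-assemble-splitAt' (maxL w) w))

tortoiseAux-[] : ∀ f → tortoiseAux f [] ≡ []
tortoiseAux-[] zero    = refl
tortoiseAux-[] (suc f) = refl

tortoiseAux-unfold : ∀ f w → tortoiseAux (suc f) w ≡ assemble (maxL w) (map (tortoiseAux f) (splitAt' (maxL w) w))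
tortoiseAux-unfold f []      = sym (trans (++-identityʳ (tortoiseAux f [])) (tortoiseAux-[] f))
tortoiseAux-unfold f (_ ∷ _) = refl

maxL-zeros : ∀ k → maxL (replicate k 0) ≡ 0
maxL-zeros zero    = refl
maxL-zeros (suc k) = maxL-zeros k

splitAt'-zeros : ∀ k → splitAt' 0 (replicate k 0) ≡ replicate (suc k) []
splitAt'-zeros zero    = refl
splitAt'-zeros (suc k) rewrite splitAt'-zeros k = refl

assemble-empties : ∀ M k → assemble M (replicate (suc k) []) ≡ replicate k M
assemble-empties M zero    = refl
assemble-empties M (suc k) = cong (M ∷_) (assemble-empties M k)

tortoiseAux-zeros : ∀ f k → tortoiseAux (suc f) (replicate k 0) ≡ replicate k 0
tortoiseAux-zeros f k = begin
  tortoiseAux (suc f) z                           ≡⟨ tortoiseAux-unfold f z ⟩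
  assemble (maxL z) (map T (splitAt' (maxL z) z)) ≡⟨ cong (λ M → assemble M (map T (splitAt' M z))) (maxL-zeros k) ⟩
  assemble 0 (map T (splitAt' 0 z))               ≡⟨ cong (assemble 0 ∘ map T) (splitAt'-zeros k) ⟩
  assemble 0 (map T (replicate (suc k) []))       ≡⟨ cong (assemble 0) (map-replicate T (suc k) []) ⟩
  assemble 0 (replicate (suc k) (T []))           ≡⟨ cong (assemble 0 ∘ replicate (suc k)) (tortoiseAux-[] f) ⟩
  assemble 0 (replicate (suc k) [])               ≡⟨ assemble-empties 0 k ⟩
  z                                               ∎
  where
  open ≡-Reasoning
  z = replicate k 0
  T = tortoiseAux f

isBit-⊔ : ∀ {x y} → IsBit x → IsBit y → IsBit (x ⊔ y)
isBit-⊔ bit0 q = q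
isBit-⊔ bit1 bit0 = bit1
isBit-⊔ bit1 bit1 = bit1

isBit-maxL : ∀ {x} → All IsBit x → IsBit (maxL x)
isBit-maxL []       = bit0
isBit-maxL (p ∷ ps) = isBit-⊔ p (isBit-maxL ps)

maxL-binary : ∀ a {x} → All IsBit x → maxL (replicate a 0 ++ 1 ∷ x) ≡ 1
maxL-binary (suc a) bits = maxL-binary a bits
maxL-binary zero {x} bits with maxL x | isBit-maxL bits
... | _ | bit0 = refl
... | _ | bit1 = refl

splitAt'-first-one : ∀ a x → splitAt' 1 (replicate a 0 ++ 1 ∷ x) ≡ replicate a 0 ∷ splitAt' 1 x
splitAt'-first-one zero    x = refl
splitAt'-first-one (suc a) x rewrite splitAt'-first-one a x = refl

splitAt'-binary : ∀ {x} → All IsBit x → All (λ b → ∃ λ k → b ≡ replicate k 0) (splitAt' 1 x)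
splitAt'-binary [] = (0 , refl) ∷ []
splitAt'-binary (bit1 ∷ bits) = (0 , refl) ∷ splitAt'-binary bits
splitAt'-binary {0 ∷ xs} (bit0 ∷ bits) with splitAt' 1 xs | splitAt'-binary bits
... | []     | []             = (1 , refl) ∷ []
... | b ∷ bs | (k , refl) ∷ zs = (suc k , refl) ∷ zs

-- The zero blocks of x are reached with fuel 1 + f, and only nonzero fuel leaves them unchanged.
tortoiseAux-binary : ∀ f a {x} → All IsBit x →
                     tortoiseAux (2 + f) (replicate a 0 ++ 1 ∷ x) ≡ replicate a 0 ++ x ++ [ 1 ]
tortoiseAux-binary f a {x} bits = begin
  tortoiseAux (2 + f) w
    ≡⟨ tortoiseAux-unfold (suc f) w ⟩
  assemble (maxL w) (map T (splitAt' (maxL w) w))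
    ≡⟨ cong (λ M → assemble M (map T (splitAt' M w))) (maxL-binary a bits) ⟩
  assemble 1 (map T (splitAt' 1 w))
    ≡⟨ cong (assemble 1 ∘ map T) (splitAt'-first-one a x) ⟩
  T (replicate a 0) ++ blocks (map T (splitAt' 1 x))
    ≡⟨ cong₂ (λ u v → u ++ blocks v) (tortoiseAux-zeros f a)
             (map-id-local (All.map fixes-zeros (splitAt'-binary bits))) ⟩
  replicate a 0 ++ blocks (splitAt' 1 x)
    ≡⟨ cong (replicate a 0 ++_) (splitAt'-concat 1 x) ⟩
  replicate a 0 ++ x ++ [ 1 ]
    ∎
  where
  open ≡-Reasoning
  w = replicate a 0 ++ 1 ∷ x
  T = tortoiseAux (suc f)
  blocks = concatMap (λ c → c ++ [ 1 ])
  fixes-zeros : ∀ {b} → ∃ (λ k → b ≡ replicate k 0) → T b ≡ b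
  fixes-zeros (k , refl) = tortoiseAux-zeros f k

delete-first-one : ∀ a c {x y : List ℕ} → replicate a 0 ++ x ++ [ 1 ] ≡ replicate c 0 ++ y ++ [ 1 ] →
                   replicate a 0 ++ x ≡ replicate c 0 ++ y
delete-first-one a c {x} {y} e =
  ++-cancelʳ [ 1 ] _ _ (trans (++-assoc (replicate a 0) x [ 1 ]) (trans e (sym (++-assoc (replicate c 0) y [ 1 ]))))

reinsert-first-one : ∀ {a c} {x y : List ℕ} → a ≡ c → replicate a 0 ++ x ≡ replicate c 0 ++ y →
                     replicate a 0 ++ 1 ∷ x ≡ replicate c 0 ++ 1 ∷ y
reinsert-first-one {a} {x = x} {y} refl δ = cong (λ z → replicate a 0 ++ 1 ∷ z) (++-cancelˡ (replicate a 0) x y δ)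

-- Tortoise-equivalent factors

first-one : ∀ i L → ∃₂ λ a x → a ≤ 2 × All IsBit x × window i (3 + L) ≡ replicate a 0 ++ 1 ∷ x
first-one i L = prefix (isBit-tm i) (isBit-tm (1 + i)) (isBit-tm (2 + i)) refl refl refl
  where
  prefix : ∀ {b₀ b₁ b₂} → IsBit b₀ → IsBit b₁ → IsBit b₂ → tm i ≡ b₀ → tm (1 + i) ≡ b₁ → tm (2 + i) ≡ b₂ →
           ∃₂ λ a x → a ≤ 2 × All IsBit x × window i (3 + L) ≡ replicate a 0 ++ 1 ∷ x
  prefix bit1 _ _ e₀ _ _ =
    0 , window (1 + i) (2 + L) , z≤n , isBit-window (1 + i) (2 + L) , cong (_∷ window (1 + i) (2 + L)) e₀
  prefix bit0 bit1 _ e₀ e₁ _ =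
    1 , window (2 + i) (1 + L) , s≤s z≤n , isBit-window (2 + i) (1 + L) ,
    cong₂ (λ b₀ b₁ → b₀ ∷ b₁ ∷ window (2 + i) (1 + L)) e₀ e₁
  prefix bit0 bit0 bit1 e₀ e₁ e₂ =
    2 , window (3 + i) L , s≤s (s≤s z≤n) , isBit-window (3 + i) L ,
    cong₂ (λ b₀ b₁ → b₀ ∷ b₁) e₀ (cong₂ (λ b₁ b₂ → b₁ ∷ b₂ ∷ window (3 + i) L) e₁ e₂)
  prefix bit0 bit0 bit0 e₀ e₁ e₂ = ⊥-elim (tm-no-three-equal i (trans e₀ (sym e₁)) (trans e₁ (sym e₂)))

tortoise-window : ∀ i L {a x} → All IsBit x → window i (3 + L) ≡ replicate a 0 ++ 1 ∷ x →
                  tortoise (window i (3 + L)) ≡ replicate a 0 ++ x ++ [ 1 ]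
tortoise-window i L {a} bits e =
  trans (cong (λ f → tortoiseAux f (window i (3 + L))) (length-window i (3 + L)))
        (trans (cong (tortoiseAux (3 + L)) e) (tortoiseAux-binary (1 + L) a bits))

length-tortoise-window : ∀ i L → length (tortoise (window i (3 + L))) ≡ 3 + L
length-tortoise-window i L with first-one i L
... | a , x , _ , bits , e = begin
  length (tortoise (window i (3 + L)))   ≡⟨ cong length (tortoise-window i L bits e) ⟩
  length (zs ++ x ++ [ 1 ])              ≡⟨ length-++ zs ⟩
  length zs + length (x ++ [ 1 ])        ≡⟨ cong (length zs +_) (trans (length-++ x) (+-comm (length x) 1)) ⟩
  length zs + length (1 ∷ x)             ≡⟨ sym (length-++ zs) ⟩
  length (zs ++ 1 ∷ x)                   ≡⟨ cong length (sym e) ⟩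
  length (window i (3 + L))              ≡⟨ length-window i (3 + L) ⟩
  3 + L                                  ∎
  where
  open ≡-Reasoning
  zs = replicate a 0

tortoise-equivalent-length : ∀ {i j} L L′ → tortoise (window j L′) ≡ tortoise (window i (3 + L)) → L′ ≡ 3 + L
tortoise-equivalent-length {i} {j} L L′ e = from-bound L′ e bound
  where
  bound : 3 + L ≤ L′
  bound = subst (_≤ L′) (trans (cong length e) (length-tortoise-window i L))
                (≤-trans (length-tortoiseAux-≤ (length (window j L′)) (window j L′))
                         (≤-reflexive (length-window j L′)))
  from-bound : ∀ L′ → tortoise (window j L′) ≡ tortoise (window i (3 + L)) → 3 + L ≤ L′ → L′ ≡ 3 + L
  from-bound 1 _ (s≤s ())
  from-bound 2 _ (s≤s (s≤s ()))
  from-bound (suc (suc (suc L″))) e _ =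
    trans (sym (length-tortoise-window j L″)) (trans (cong length e) (length-tortoise-window i L))

window-prefix₃ : ∀ {i L b₀ b₁ b₂ z} → window i (3 + L) ≡ b₀ ∷ b₁ ∷ b₂ ∷ z →
                 tm i ≡ b₀ × tm (1 + i) ≡ b₁ × tm (2 + i) ≡ b₂ × window (3 + i) L ≡ z
window-prefix₃ e = ∷-injectiveˡ e , ∷-injectiveˡ (∷-injectiveʳ e) , ∷-injectiveˡ (∷-injectiveʳ (∷-injectiveʳ e)) ,
                   ∷-injectiveʳ (∷-injectiveʳ (∷-injectiveʳ e))

isolated-agreement-impossible : ∀ {i j N b₀ b₁ y} → 7 ≤ N →
  window i (3 + N) ≡ b₀ ∷ b₁ ∷ 0 ∷ y → window j (3 + N) ≡ 0 ∷ 0 ∷ 1 ∷ y → ¬ (b₀ ≡ 0 ⊎ b₁ ≡ 0)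
isolated-agreement-impossible {i} {j} 7≤N ew ev agreement =
  let w₀ , w₁ , w₂ , wz = window-prefix₃ ew
      v₀ , v₁ , v₂ , vz = window-prefix₃ ev
      ne₀ , ne₁ = mismatch-spreads-left {i} {j} 7≤N (λ e → 0≢1 (trans (sym w₂) (trans e v₂))) (trans wz (sym vz))
  in case agreement of λ where
       (inj₁ refl) → ne₀ (trans w₀ (sym v₀))
       (inj₂ refl) → ne₁ (trans w₁ (sym v₁))

ordered-twins : ∀ {i j N a c x y} → 7 ≤ N → a < c → c ≤ 2 →
                window i (3 + N) ≡ replicate a 0 ++ 1 ∷ x → window j (3 + N) ≡ replicate c 0 ++ 1 ∷ y →
                replicate a 0 ++ x ≡ replicate c 0 ++ y →
                tm (1 + i) ≢ tm (1 + j) × window (2 + i) (1 + N) ≡ window (2 + j) (1 + N)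
ordered-twins _ (s≤s z≤n) (s≤s z≤n) ew ev δ =
  let w₀ , w₁ = ∷-injective (∷-injectiveʳ (trans ew (cong (1 ∷_) δ)))
      v₀ , v₁ = ∷-injective (∷-injectiveʳ ev)
  in (λ e → 0≢1 (trans (sym w₀) (trans e v₀))) , trans w₁ (sym v₁)
ordered-twins 7≤N (s≤s z≤n) (s≤s (s≤s z≤n)) ew ev δ =
  ⊥-elim (isolated-agreement-impossible 7≤N (trans ew (cong (1 ∷_) δ)) ev (inj₂ refl))
ordered-twins 7≤N (s≤s (s≤s z≤n)) (s≤s (s≤s z≤n)) ew ev δ =
  ⊥-elim (isolated-agreement-impossible 7≤N (trans ew (cong (λ x → 0 ∷ 1 ∷ x) (∷-injectiveʳ δ))) ev (inj₁ refl))

tortoise-twins : ∀ {i j} N → 7 ≤ N → window i (3 + N) ≢ window j (3 + N) →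
                 tortoise (window i (3 + N)) ≡ tortoise (window j (3 + N)) →
                 tm (1 + i) ≢ tm (1 + j) × window (2 + i) (1 + N) ≡ window (2 + j) (1 + N)
tortoise-twins {i} {j} N 7≤N w≢v t≡ = twins (first-one i N) (first-one j N)
  where
  Twins = tm (1 + i) ≢ tm (1 + j) × window (2 + i) (1 + N) ≡ window (2 + j) (1 + N)
  FirstOne = λ k → ∃₂ λ a x → a ≤ 2 × All IsBit x × window k (3 + N) ≡ replicate a 0 ++ 1 ∷ x
  twins : FirstOne i → FirstOne j → Twins
  twins (a , x , a≤2 , x-bits , ew) (c , y , c≤2 , y-bits , ev) = by-cases (<-cmp a c)
    where
    δ : replicate a 0 ++ x ≡ replicate c 0 ++ y
    δ = delete-first-one a c (trans (sym (tortoise-window i N x-bits ew)) (trans t≡ (tortoise-window j N y-bits ev)))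
    by-cases : Tri (a < c) (a ≡ c) (c < a) → Twins
    by-cases (tri< a<c _ _)  = ordered-twins 7≤N a<c c≤2 ew ev δ
    by-cases (tri≈ _ a≡c _)  = ⊥-elim (w≢v (trans ew (trans (reinsert-first-one a≡c δ) (sym ev))))
    by-cases (tri> _ _ c<a)  = let ne , agree = ordered-twins 7≤N c<a a≤2 ev ew (sym δ) in ne ∘ sym , sym agree

-- Counter words

⌊n/2⌋≡n/2 : ∀ n → ⌊ n /2⌋ ≡ n / 2
⌊n/2⌋≡n/2 zero          = refl
⌊n/2⌋≡n/2 (suc zero)    = refl
⌊n/2⌋≡n/2 (suc (suc n)) = trans (cong suc (⌊n/2⌋≡n/2 n)) (sym (m/n≡1+[m∸n]/n {2 + n} {2} (s≤s (s≤s z≤n))))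

quotient-bounds : ∀ n d .{{_ : NonZero d}} → n / d * d ≤ n × n < suc (n / d) * d
quotient-bounds n d = m/n*n≤m n d , (begin-strict
  n                       ≡⟨ m≡m%n+[m/n]*n n d ⟩
  n % d + n / d * d       <⟨ +-monoˡ-< (n / d * d) (m%n<n n d) ⟩
  d + n / d * d           ∎)
  where open ≤-Reasoning

shiftR-bounds : ∀ n j → shiftR n j * 2 ^ j ≤ n × n < suc (shiftR n j) * 2 ^ j
shiftR-bounds n zero    = ≤-reflexive (*-identityʳ n) , ≤-reflexive (cong suc (sym (*-identityʳ n)))
shiftR-bounds n (suc j) =
  let s = shiftR n j
      h = ⌊ s /2⌋
      sx≤n , n<[1+s]x = shiftR-bounds n j
      2h≤s , s<2[1+h] = subst (λ q → q * 2 ≤ s × s < suc q * 2) (sym (⌊n/2⌋≡n/2 s)) (quotient-bounds s 2)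
  in ≤-trans (≤-reflexive (regroup h)) (≤-trans (*-monoˡ-≤ (2 ^ j) 2h≤s) sx≤n) ,
     ≤-trans n<[1+s]x (≤-trans (*-monoˡ-≤ (2 ^ j) s<2[1+h]) (≤-reflexive (sym (regroup (suc h)))))
  where
  regroup : ∀ q → q * 2 ^ suc j ≡ q * 2 * 2 ^ j
  regroup q = sym (*-assoc q 2 (2 ^ j))

-- Under these bounds bit N r is the second binary digit of N.
bit-bounds : ∀ N r → 2 ^ suc r ≤ N → N < 2 ^ (2 + r) →
             (bit N r ≡ 0 → N < 3 * 2 ^ r) × (bit N r ≡ 1 → 3 * 2 ^ r ≤ N)
bit-bounds N r lower upper = by-quotient (shiftR N r) 2≤q q<4 qx≤N N<[1+q]x
  where
  qx≤N = proj₁ (shiftR-bounds N r)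
  N<[1+q]x = proj₂ (shiftR-bounds N r)
  2≤q : 2 ≤ shiftR N r
  2≤q = ≤-pred (*-cancelʳ-< (2 ^ r) 2 (suc (shiftR N r)) (≤-<-trans lower N<[1+q]x))
  q<4 : shiftR N r < 4
  q<4 = *-cancelʳ-< (2 ^ r) (shiftR N r) 4 (≤-<-trans qx≤N (subst (N <_) (sym (*-assoc 2 2 (2 ^ r))) upper))
  by-quotient : ∀ q → 2 ≤ q → q < 4 → q * 2 ^ r ≤ N → N < suc q * 2 ^ r →
                (q % 2 ≡ 0 → N < 3 * 2 ^ r) × (q % 2 ≡ 1 → 3 * 2 ^ r ≤ N)
  by-quotient 2 _ _ _ N<3x = (λ _ → N<3x) , (λ ())
  by-quotient 3 _ _ 3x≤N _ = (λ ()) , (λ _ → 3x≤N)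
  by-quotient 0 () _ _ _
  by-quotient 1 (s≤s ()) _ _ _
  by-quotient (suc (suc (suc (suc _)))) _ (s≤s (s≤s (s≤s (s≤s ())))) _ _

2≤2^r : ∀ r {N} → 8 ≤ N → N < 2 ^ (2 + r) → 2 ≤ 2 ^ r
2≤2^r zero    8≤N N<4 = ⊥-elim (<⇒≱ N<4 (≤-trans (s≤s (s≤s (s≤s (s≤s z≤n)))) 8≤N))
2≤2^r (suc r) _   _   = *-monoʳ-≤ 2 (m^n>0 2 r)

window-lift : ∀ r {k A C} L n → 2 ≤ 2 ^ r → n ≤ 2 + 2 ^ r * L → 2 + k ≡ 2 ^ r * suc A →
              window A (suc L) ≡ window C (suc L) → window k n ≡ window (2 ^ r * suc C ∸ 2) n
window-lift r {k} {A} {C} L n 2≤x n≤2+xL ek e =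
  subst₂ (λ p q → window p n ≡ window q n) (sym (position-k)) (sym (position C))
         (window-shift d n fits (window-2^r* r (suc L) e))
  where
  x = 2 ^ r
  d = x ∸ 2
  position : ∀ B → x * suc B ∸ 2 ≡ d + x * B
  position B = trans (cong (_∸ 2) (*-suc x B)) (+-∸-comm (x * B) 2≤x)
  position-k : k ≡ d + x * A
  position-k = trans (cong (_∸ 2) ek) (position A)
  fits : d + n ≤ x * suc L
  fits = begin
    d + n            ≤⟨ +-monoʳ-≤ d n≤2+xL ⟩
    d + (2 + x * L)  ≡⟨ sym (+-assoc d 2 (x * L)) ⟩
    d + 2 + x * L    ≡⟨ cong (_+ x * L) (m∸n+n≡m 2≤x) ⟩
    x + x * L        ≡⟨ sym (*-suc x L) ⟩
    x * suc L        ∎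
    where open ≤-Reasoning

AmongCounters₁₂₃₄ AmongCounters₁₄ : ℕ → ℕ → List ℕ → Set
AmongCounters₁₂₃₄ m n u = u ≡ counter₁ m n ⊎ u ≡ counter₂ m n ⊎ u ≡ counter₃ m n ⊎ u ≡ counter₄ m n
AmongCounters₁₄ m n u = u ≡ counter₁ m n ⊎ u ≡ counter₄ m n

OneIsCounter : ℕ → ℕ → List ℕ → List ℕ → Set
OneIsCounter m n w v = (bit (n ∸ 3) (m ∸ 2) ≡ 0 → AmongCounters₁₂₃₄ m n w ⊎ AmongCounters₁₂₃₄ m n v)
                     × (bit (n ∸ 3) (m ∸ 2) ≡ 1 → AmongCounters₁₄ m n w ⊎ AmongCounters₁₄ m n v)

counter-position : ∀ r n c {p} → p ≡ 2 ^ r * c → factorAt (p ∸ 2) n ≡ window (2 ^ r * c ∸ 2) n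
counter-position r n c e = trans (cong (λ q → factorAt (q ∸ 2) n) e) (factorAt≡window (2 ^ r * c ∸ 2) n)

2^[2+r+1]≡2^r*8 : ∀ r → 2 ^ (2 + r + 1) ≡ 2 ^ r * 8
2^[2+r+1]≡2^r*8 r = trans (cong (λ q → 2 * (2 * q)) (^-distribˡ-+-* 2 r 1)) (*8 (2 ^ r))
  where
  *8 : ∀ x → 2 * (2 * (x * 2)) ≡ x * 8
  *8 = solve-∀

counter₁≡ : ∀ r n → counter₁ (2 + r) n ≡ window (2 ^ r * 8 ∸ 2) n
counter₁≡ r n = counter-position r n 8 (2^[2+r+1]≡2^r*8 r)

counter₂≡ : ∀ r n → counter₂ (2 + r) n ≡ window (2 ^ r * 10 ∸ 2) n
counter₂≡ r n = counter-position r n 10 (trans (cong (_+ 2 * 2 ^ r) (2^[2+r+1]≡2^r*8 r)) (8+2≡10 (2 ^ r)))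
  where
  8+2≡10 : ∀ x → x * 8 + 2 * x ≡ x * 10
  8+2≡10 = solve-∀

counter₃≡ : ∀ r n → counter₃ (2 + r) n ≡ window (2 ^ r * 11 ∸ 2) n
counter₃≡ r n =
  counter-position r n 11 (trans (cong (λ p → p + 2 * 2 ^ r + 2 ^ r) (2^[2+r+1]≡2^r*8 r)) (8+2+1≡11 (2 ^ r)))
  where
  8+2+1≡11 : ∀ x → x * 8 + 2 * x + x ≡ x * 11
  8+2+1≡11 = solve-∀

counter₄≡ : ∀ r n → counter₄ (2 + r) n ≡ window (2 ^ r * 12 ∸ 2) n
counter₄≡ r n = counter-position r n 12 (trans (cong (_+ 2 * (2 * 2 ^ r)) (2^[2+r+1]≡2^r*8 r)) (8+4≡12 (2 ^ r)))
  where
  8+4≡12 : ∀ x → x * 8 + 2 * (2 * x) ≡ x * 12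
  8+4≡12 = solve-∀

among-counters₁₂₃₄ : ∀ r n {u} → Any (λ C → u ≡ window (2 ^ r * suc C ∸ 2) n) (7 ∷ 9 ∷ 10 ∷ 11 ∷ []) →
                     AmongCounters₁₂₃₄ (2 + r) n u
among-counters₁₂₃₄ r n (here e)                         = inj₁ (trans e (sym (counter₁≡ r n)))
among-counters₁₂₃₄ r n (there (here e))                 = inj₂ (inj₁ (trans e (sym (counter₂≡ r n))))
among-counters₁₂₃₄ r n (there (there (here e)))         = inj₂ (inj₂ (inj₁ (trans e (sym (counter₃≡ r n)))))
among-counters₁₂₃₄ r n (there (there (there (here e)))) = inj₂ (inj₂ (inj₂ (trans e (sym (counter₄≡ r n)))))

among-counters₁₄ : ∀ r n {u} → Any (λ C → u ≡ window (2 ^ r * suc C ∸ 2) n) (7 ∷ 11 ∷ []) →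
                   AmongCounters₁₄ (2 + r) n u
among-counters₁₄ r n (here e)         = inj₁ (trans e (sym (counter₁≡ r n)))
among-counters₁₄ r n (there (here e)) = inj₂ (trans e (sym (counter₄≡ r n)))

twins-are-counters : ∀ r N {i j} → 8 ≤ N → 2 ^ suc r ≤ N → N < 2 ^ (2 + r) →
  tm (1 + i) ≢ tm (1 + j) → window (2 + i) (1 + N) ≡ window (2 + j) (1 + N) →
  OneIsCounter (2 + r) (3 + N) (window i (3 + N)) (window j (3 + N))
twins-are-counters r N {i} {j} 8≤N lower upper ne agree =
  from-desubstitution (desubstitute r {1 + i} {1 + j} {1 + N} bound ne agree)
  where
  x = 2 ^ r
  n = 3 + N
  bound : 3 * x < 2 * suc N
  bound = begin-strict
    3 * x        ≤⟨ *-monoˡ-≤ x (n≤1+n 3) ⟩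
    4 * x        ≡⟨ *-assoc 2 2 x ⟩
    2 * (2 * x)  ≤⟨ *-monoʳ-≤ 2 lower ⟩
    2 * N        <⟨ *-monoʳ-< 2 (n<1+n N) ⟩
    2 * suc N    ∎
    where open ≤-Reasoning
  from-desubstitution : (∃₂ λ P Q → 2 + i ≡ x * suc P × 2 + j ≡ x * suc Q × tm P ≢ tm Q) →
                        OneIsCounter (2 + r) n (window i n) (window j n)
  from-desubstitution (P , Q , eP , eQ , P≢Q) = on-bit-0 , on-bit-1
    where
    sampled : ∀ M → x * M < 1 + N → window (suc P) (suc M) ≡ window (suc Q) (suc M)
    sampled M xM<1+N = window-sample r M xM<1+N (subst₂ (λ A B → window A (1 + N) ≡ window B (1 + N)) eP eQ agree)
    lift : ∀ {Cs} L → n ≤ 2 + x * L → OccursAt Cs (suc L) P ⊎ OccursAt Cs (suc L) Q →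
           Any (λ C → window i n ≡ window (x * suc C ∸ 2) n) Cs ⊎ Any (λ C → window j n ≡ window (x * suc C ∸ 2) n) Cs
    lift L fits = Sum.map (Any.map (window-lift r L n (2≤2^r r 8≤N upper) fits eP))
                          (Any.map (window-lift r L n (2≤2^r r 8≤N upper) fits eQ))
    on-bit-0 : bit N r ≡ 0 → AmongCounters₁₂₃₄ (2 + r) n (window i n) ⊎ AmongCounters₁₂₃₄ (2 + r) n (window j n)
    on-bit-0 b = Sum.map (among-counters₁₂₃₄ r n) (among-counters₁₂₃₄ r n)
      (lift 3 (s≤s (s≤s (subst (N <_) (*-comm 3 x) (proj₁ (bit-bounds N r lower upper) b))))
        (left-special-4 P Q P≢Q (sampled 2 (s≤s (subst (_≤ N) (*-comm 2 x) lower)))))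
    on-bit-1 : bit N r ≡ 1 → AmongCounters₁₄ (2 + r) n (window i n) ⊎ AmongCounters₁₄ (2 + r) n (window j n)
    on-bit-1 b = Sum.map (among-counters₁₄ r n) (among-counters₁₄ r n)
      (lift 4 (s≤s (s≤s (subst (N <_) (trans (sym (*-assoc 2 2 x)) (*-comm 4 x)) upper)))
        (left-special-5 P Q P≢Q
          (sampled 3 (s≤s (subst (_≤ N) (*-comm 3 x) (proj₂ (bit-bounds N r lower upper) b))))))

theorem5 : (n m : ℕ) → 11 ≤ n → 2 ^ (m ∸ 1) ≤ n ∸ 3 → n ∸ 3 < 2 ^ m →
    (w v : List ℕ) → IsFactor w → length w ≡ n → IsFactor v → v ≢ w → tortoise v ≡ tortoise w →
    ((bit (n ∸ 3) (m ∸ 2) ≡ 0 →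
       (w ≡ counter₁ m n ⊎ w ≡ counter₂ m n ⊎ w ≡ counter₃ m n ⊎ w ≡ counter₄ m n)
       ⊎ (v ≡ counter₁ m n ⊎ v ≡ counter₂ m n ⊎ v ≡ counter₃ m n ⊎ v ≡ counter₄ m n))
    × (bit (n ∸ 3) (m ∸ 2) ≡ 1 →
       (w ≡ counter₁ m n ⊎ w ≡ counter₄ m n) ⊎ (v ≡ counter₁ m n ⊎ v ≡ counter₄ m n)))
theorem5 _ 0 (s≤s (s≤s (s≤s 8≤N))) _ N<1 _ _ _ _ _ _ _ = ⊥-elim (<⇒≱ N<1 (≤-trans (s≤s z≤n) 8≤N))
theorem5 _ 1 (s≤s (s≤s (s≤s 8≤N))) _ N<2 _ _ _ _ _ _ _ = ⊥-elim (<⇒≱ N<2 (≤-trans (s≤s (s≤s z≤n)) 8≤N))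
theorem5 _ (suc (suc r)) (s≤s (s≤s (s≤s {n = N} 8≤N))) lower upper w v (i , w≡) |w|≡n (j , v≡) v≢w t≡ =
  subst₂ (OneIsCounter (2 + r) n) (sym w≡window) (sym v≡window) (twins-are-counters r N 8≤N lower upper ne agree)
  where
  n = 3 + N
  w≡window : w ≡ window i n
  w≡window = trans w≡ (trans (cong (factorAt i) |w|≡n) (factorAt≡window i n))
  v≡window-|v| : v ≡ window j (length v)
  v≡window-|v| = trans v≡ (factorAt≡window j (length v))
  v≡window : v ≡ window j n
  v≡window = trans v≡window-|v| (cong (window j) (tortoise-equivalent-length {i} {j} N (length v)
               (trans (cong tortoise (sym v≡window-|v|)) (trans t≡ (cong tortoise w≡window)))))
  twins = tortoise-twins {i} {j} N (≤-trans (n≤1+n 7) 8≤N)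
                         (λ e → v≢w (trans v≡window (trans (sym e) (sym w≡window))))
                         (trans (cong tortoise (sym w≡window)) (trans (sym t≡) (cong tortoise v≡window)))
  ne = proj₁ twins
  agree = proj₂ twins
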